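{- Let $n\ge2$ be a power of $2$ and let $Q \subseteq \{0,1,\dots,n-1\}$ be a subset of size $q > 0$. Then $|\mathsf{bin\text{ - }prof}(Q)| \leq q-1$, where $\mathsf{bin\text{ - }prof}(Q)=\{i\in[\log_2 n] : \text{there exist } x,y\in Q \text{ with } M(x,y)=i\}$.
   Context: Every $t\in\{0,\dots,n-1\}$ has a unique binary representation $(b^t_1,\dots,b^t_{\log_2 n})$ with $t=\sum_j b^t_j2^{j-1}$. For distinct $x,y$, $M(x,y)$ is the largest index $i$ with $b^x_i\ne b^y_i$. -}

module Defs where

open import Data.Nat using (ℕ; zero; suc; _^_; _<_; _≤_)
open import Data.Nat.DivMod using (_/_; _%_)
open import Data.Nat.Properties using (_≟_; m^n>0)
open import Data.Nat.Base using (>-nonZero)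
open import Data.Fin using (Fin; toℕ)
open import Data.Fin.Subset using (Subset; _∈_)
open import Data.Product using (Σ; _×_; ∃-syntax)
open import Relation.Nullary using (¬_)
open import Relation.Binary.PropositionalEquality using (_≡_)

-- Bit of t at (0-based) position i, i.e. the paper's b^t_{i+1} = ⌊t / 2^i⌋ mod 2.
bit : ℕ → ℕ → ℕ
bit i t = (_/_ t (2 ^ i) {{>-nonZero (m^n>0 2 i)}}) % 2

-- Paper's M(x,y) = i+1 (0-based index i ∈ Fin k, k = log₂ n):
-- bits of x and y differ at position i and agree at every higher position j < k.
IsM : (k : ℕ) → Fin (2 ^ k) → Fin (2 ^ k) → Fin k → Set
IsM k x y i =
  (¬ bit (toℕ i) (toℕ x) ≡ bit (toℕ i) (toℕ y)) ×
  ((j : ℕ) → toℕ i < j → j < k → bit j (toℕ x) ≡ bit j (toℕ y))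

InBinProf : (k : ℕ) → Subset (2 ^ k) → Fin k → Set
InBinProf k Q i = ∃[ x ] ∃[ y ] (x ∈ Q × y ∈ Q × ¬ x ≡ y × IsM k x y i)

module Submission where

-- Work with natural numbers and write high i t = ⌊t / 2^i⌋ for the bits of t at
-- positions ≥ i.  Two numbers x, y "split at level i" when high (i+1) agrees on
-- them but high i does not; for x, y < 2^k this is the paper's M(x,y) = i+1.
-- Two facts about this relation drive the proof:
--   * uniqueness: a pair x, y splits at most at one level;
--   * betweenness: if x ≤ p ≤ y then the level of (x,y) is the level of (x,p)
--     or of (p,y).
-- List the elements of Q increasingly as x₀ < x₁ < ….  By betweenness, every
-- level realised by a pair of Q is realised by the pair (x₀,x₁) or by a pair of
-- x₁ < x₂ < …; by uniqueness the first case contributes at most one level.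

open import Defs
open import Data.Nat using (ℕ; zero; suc; _^_; _≤_; _<_; _∸_; _+_; _*_; s≤s; z<s; s<s; NonZero)
open import Data.Nat.Properties
open import Data.Nat.DivMod using (_/_; _%_; /-congʳ; m/n/o≡m/[n*o]; /-monoˡ-≤; m<n⇒m/n≡0; m≡m%n+[m/n]*n)
open import Data.Fin using (Fin; toℕ; zero; suc)
open import Data.Fin.Properties using (toℕ-injective; toℕ<n; any?)
open import Data.Fin.Subset using (Subset; _∈_; ∣_∣; _─_; _-_; ⁅_⁆; Empty; inside; outside)
open import Data.Fin.Subset.Properties using (p─⊥≡p; p─q⊆p; x∉⁅y⁆⇒x≢y; Empty-unique; ∣⊥∣≡0)
open import Data.Vec using ([]; _∷_; here; there)
open import Data.List using (List; []; _∷_; map; length)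
open import Data.List.Properties using (length-map)
open import Data.List.Membership.Propositional using () renaming (_∈_ to _∈ₗ_)
open import Data.List.Membership.Propositional.Properties using (∈-map⁺)
open import Data.List.Relation.Unary.Any using (here; there)
import Data.List.Relation.Unary.All as All
import Data.List.Relation.Unary.All.Properties as All
open import Data.List.Relation.Unary.AllPairs using (AllPairs; []; _∷_)
import Data.List.Relation.Unary.AllPairs as AllPairs
import Data.List.Relation.Unary.AllPairs.Properties as AllPairs
open import Data.Product using (_×_; _,_; ∃-syntax)
open import Data.Sum using (_⊎_; inj₁; inj₂; [_,_]′)
open import Function using (id; _∘_)
open import Function.Bundles using (_⇔_; Equivalence)
open import Relation.Nullary using (¬_; yes; no; Dec; ¬?; contradiction)
open import Relation.Nullary.Decidable using (_×-dec_; map′)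
open import Relation.Unary using (Decidable)
open import Relation.Binary.PropositionalEquality
open import Relation.Binary.Definitions using (tri<; tri≈; tri>)

2^-nonZero : ∀ i → NonZero (2 ^ i)
2^-nonZero i = m^n≢0 2 i

high : ℕ → ℕ → ℕ
high i t = _/_ t (2 ^ i) {{2^-nonZero i}}

high-+ : ∀ a b t → high (a + b) t ≡ high b (high a t)
high-+ a b t = begin
  high (a + b) t
    ≡⟨ /-congʳ {{2^-nonZero (a + b)}} (^-distribˡ-+-* 2 a b) ⟩
  t / (2 ^ a * 2 ^ b)
    ≡⟨ m/n/o≡m/[n*o] t (2 ^ a) (2 ^ b) {{2^-nonZero a}} {{2^-nonZero b}} ⟨
  high b (high a t)
    ∎
  where
  open ≡-Reasoning
  instance
    2^a*2^b-nonZero : NonZero (2 ^ a * 2 ^ b)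
    2^a*2^b-nonZero = m*n≢0 (2 ^ a) (2 ^ b) {{2^-nonZero a}} {{2^-nonZero b}}

high-decomp : ∀ i t → high i t ≡ bit i t + high (suc i) t * 2
high-decomp i t = begin
  high i t                                ≡⟨ m≡m%n+[m/n]*n (high i t) 2 ⟩
  bit i t + high 1 (high i t) * 2         ≡⟨ cong (λ h → bit i t + h * 2) (high-+ i 1 t) ⟨
  bit i t + high (i + 1) t * 2            ≡⟨ cong (λ j → bit i t + high j t * 2) (+-comm i 1) ⟩
  bit i t + high (suc i) t * 2            ∎
  where open ≡-Reasoning

high-mono : ∀ i {x y} → x ≤ y → high i x ≤ high i y
high-mono i = /-monoˡ-≤ (2 ^ i) {{2^-nonZero i}}

high-agree-above : ∀ {a b x y} → a ≤ b → high a x ≡ high a y → high b x ≡ high b y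
high-agree-above {a} {x = x} {y} a≤b eq with m≤n⇒∃[o]m+o≡n a≤b
... | d , refl = begin
  high (a + d) x     ≡⟨ high-+ a d x ⟩
  high d (high a x)  ≡⟨ cong (high d) eq ⟩
  high d (high a y)  ≡⟨ high-+ a d y ⟨
  high (a + d) y     ∎
  where open ≡-Reasoning

high-agree-below : ∀ a d {x y} → (∀ j → a ≤ j → j < a + d → bit j x ≡ bit j y) →
                   high (a + d) x ≡ high (a + d) y → high a x ≡ high a y
high-agree-below a zero {x} {y} _ eq = subst (λ j → high j x ≡ high j y) (+-identityʳ a) eq
high-agree-below a (suc d) {x} {y} bits eq = begin
  high a x                        ≡⟨ high-decomp a x ⟩
  bit a x + high (suc a) x * 2    ≡⟨ cong₂ (λ b h → b + h * 2) (bits a ≤-refl (m<m+n a z<s)) above ⟩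
  bit a y + high (suc a) y * 2    ≡⟨ high-decomp a y ⟨
  high a y                        ∎
  where
  open ≡-Reasoning
  above : high (suc a) x ≡ high (suc a) y
  above = high-agree-below (suc a) d
            (λ j a<j j<a+d → bits j (<⇒≤ a<j) (subst (j <_) (sym (+-suc a d)) j<a+d))
            (subst (λ j → high j x ≡ high j y) (+-suc a d) eq)

high-small : ∀ k {t} → t < 2 ^ k → high k t ≡ 0
high-small k = m<n⇒m/n≡0 {{2^-nonZero k}}

-- x and y split at level i: they agree at all bit positions above i but differ
-- at position i.  For distinct x, y < 2^k this is the paper's M(x,y) = i+1.
record SplitsAt (x y i : ℕ) : Set where
  constructor splits
  field
    agree-above : high (suc i) x ≡ high (suc i) y
    differ-at   : ¬ high i x ≡ high i y

splitsAt? : ∀ x y i → Dec (SplitsAt x y i)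
splitsAt? x y i = map′ (λ (a , d) → splits a d) (λ (splits a d) → a , d)
  ((high (suc i) x ≟ high (suc i) y) ×-dec ¬? (high i x ≟ high i y))

splitsAt-sym : ∀ {x y i} → SplitsAt x y i → SplitsAt y x i
splitsAt-sym (splits above differ) = splits (sym above) (differ ∘ sym)

splitsAt⇒≢ : ∀ {x y i} → SplitsAt x y i → ¬ x ≡ y
splitsAt⇒≢ (splits _ differ) refl = differ refl

splitsAt-unique : ∀ {x y i j} → SplitsAt x y i → SplitsAt x y j → i ≡ j
splitsAt-unique {i = i} {j} (splits i-above i-differ) (splits j-above j-differ) with <-cmp i j
... | tri< i<j _ _ = contradiction (high-agree-above i<j i-above) j-differ
... | tri≈ _ i≡j _ = i≡j
... | tri> _ _ j<i = contradiction (high-agree-above j<i j-above) i-differ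

-- Betweenness: a point p between x and y splits off the level of (x,y) from one
-- of the two ends.  Monotonicity of high (i+1) squeezes p into the common prefix.
splitsAt-between : ∀ {x p y i} → x ≤ p → p ≤ y → SplitsAt x y i →
                   SplitsAt x p i ⊎ SplitsAt p y i
splitsAt-between {x} {p} {y} {i} x≤p p≤y (splits above differ) with high i x ≟ high i p
... | no x≢p = inj₁ (splits x≡p x≢p)
  where
  x≡p : high (suc i) x ≡ high (suc i) p
  x≡p = ≤-antisym (high-mono (suc i) x≤p) (subst (high (suc i) p ≤_) (sym above) (high-mono (suc i) p≤y))
... | yes x≡p = inj₂ (splits p≡y (λ p≡y′ → differ (trans x≡p p≡y′)))
  where
  p≡y : high (suc i) p ≡ high (suc i) y
  p≡y = ≤-antisym (high-mono (suc i) p≤y) (subst (_≤ high (suc i) p) above (high-mono (suc i) x≤p))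

-- The paper's M(x,y) = i+1, as formalised by IsM, is an instance of SplitsAt:
-- both numbers vanish above position k and agree on the bits between i+1 and k.
isM⇒splitsAt : ∀ k {x y : Fin (2 ^ k)} {i : Fin k} → IsM k x y i →
               SplitsAt (toℕ x) (toℕ y) (toℕ i)
isM⇒splitsAt k {x} {y} {i} (bit-differs , bits-agree) = splits above (bit-differs ∘ cong (_% 2))
  where
  k≡1+i+d : suc (toℕ i) + (k ∸ suc (toℕ i)) ≡ k
  k≡1+i+d = m+[n∸m]≡n (toℕ<n i)
  top : high k (toℕ x) ≡ high k (toℕ y)
  top = trans (high-small k (toℕ<n x)) (sym (high-small k (toℕ<n y)))
  above : high (suc (toℕ i)) (toℕ x) ≡ high (suc (toℕ i)) (toℕ y)
  above = high-agree-below (suc (toℕ i)) (k ∸ suc (toℕ i))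
            (λ j i<j j<k → bits-agree j i<j (subst (j <_) k≡1+i+d j<k))
            (subst (λ j → high j (toℕ x) ≡ high j (toℕ y)) (sym k≡1+i+d) top)

∣p∣≤1+∣p-x∣ : ∀ {n} (p : Subset n) (x : Fin n) → ∣ p ∣ ≤ suc ∣ p - x ∣
∣p∣≤1+∣p-x∣ (inside ∷ p) zero = s≤s (≤-reflexive (cong ∣_∣ (sym (p─⊥≡p p))))
∣p∣≤1+∣p-x∣ (outside ∷ p) zero = m≤n⇒m≤1+n (≤-reflexive (cong ∣_∣ (sym (p─⊥≡p p))))
∣p∣≤1+∣p-x∣ (inside ∷ p) (suc x) = s≤s (∣p∣≤1+∣p-x∣ p x)
∣p∣≤1+∣p-x∣ (outside ∷ p) (suc x) = ∣p∣≤1+∣p-x∣ p x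

x∈p─q⇒x∉q : ∀ {n} {p q : Subset n} {x} → x ∈ p ─ q → ¬ x ∈ q
x∈p─q⇒x∉q {p = _ ∷ _} {outside ∷ _} (there x∈p─q) (there x∈q) = x∈p─q⇒x∉q x∈p─q x∈q
x∈p─q⇒x∉q {p = _ ∷ _} {inside ∷ _} (there x∈p─q) (there x∈q) = x∈p─q⇒x∉q x∈p─q x∈q

peel : ∀ {n} {C P : Fin n → Set} → Decidable C → (∀ {i j} → C i → C j → i ≡ j) →
       (B : Subset n) → (∀ i → i ∈ B → C i ⊎ P i) →
       ∃[ B′ ] (∣ B ∣ ≤ suc ∣ B′ ∣ × (∀ i → i ∈ B′ → P i))
peel {P = P} C? C-unique B C-or-P with any? C?
... | no ¬∃C = B , n≤1+n _ , λ i i∈B → [ (λ c → contradiction (i , c) ¬∃C) , id ]′ (C-or-P i i∈B)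
... | yes (i₀ , c₀) = B - i₀ , ∣p∣≤1+∣p-x∣ B i₀ , P-on-rest
  where
  P-on-rest : ∀ i → i ∈ B - i₀ → P i
  P-on-rest i i∈B-i₀ = [ (λ c → contradiction (C-unique c c₀) i≢i₀) , id ]′ (C-or-P i i∈B)
    where
    i∈B : i ∈ B
    i∈B = p─q⊆p B ⁅ i₀ ⁆ i∈B-i₀
    i≢i₀ : ¬ i ≡ i₀
    i≢i₀ = x∉⁅y⁆⇒x≢y (x∈p─q⇒x∉q i∈B-i₀)

Realised : List ℕ → ℕ → Set
Realised xs i = ∃[ x ] ∃[ y ] (x ∈ₗ xs × y ∈ₗ xs × x < y × SplitsAt x y i)

head-≤ : ∀ {y rest b} → AllPairs _<_ (y ∷ rest) → b ∈ₗ y ∷ rest → y ≤ b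
head-≤ _ (here refl) = ≤-refl
head-≤ (y<rest ∷ _) (there b∈rest) = <⇒≤ (All.lookup y<rest b∈rest)

-- In an increasing list x ∷ y ∷ rest, a level realised by any pair is realised by
-- the first pair or by a pair of y ∷ rest (betweenness, applied with p = y).
realised-∷ : ∀ {x y rest i} → AllPairs _<_ (x ∷ y ∷ rest) → Realised (x ∷ y ∷ rest) i →
             SplitsAt x y i ⊎ Realised (y ∷ rest) i
realised-∷ _ (_ , _ , here refl , here refl , a<b , _) = contradiction a<b (<-irrefl refl)
realised-∷ {y = y} ((x<y All.∷ _) ∷ sorted) (_ , b , here refl , there b∈ , _ , s)
  with splitsAt-between (<⇒≤ x<y) (head-≤ sorted b∈) s
... | inj₁ s-xy = inj₁ s-xy
... | inj₂ s-yb = inj₂ (y , b , here refl , b∈ , y<b , s-yb)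
  where
  y<b : y < b
  y<b = ≤∧≢⇒< (head-≤ sorted b∈) (splitsAt⇒≢ s-yb)
realised-∷ (x<rest ∷ _) (a , _ , there a∈ , here refl , a<x , _) =
  contradiction (All.lookup x<rest a∈) (<-asym a<x)
realised-∷ _ (a , b , there a∈ , there b∈ , a<b , s) = inj₂ (a , b , a∈ , b∈ , a<b , s)

nothing-realised-[] : ∀ {i} → ¬ Realised [] i
nothing-realised-[] (_ , _ , () , _)

nothing-realised-[x] : ∀ {x i} → ¬ Realised (x ∷ []) i
nothing-realised-[x] (_ , _ , here refl , here refl , a<b , _) = <-irrefl refl a<b

∣empty∣≡0 : ∀ {n} (p : Subset n) → Empty p → ∣ p ∣ ≡ 0
∣empty∣≡0 {n} p empty = trans (cong ∣_∣ (Empty-unique empty)) (∣⊥∣≡0 n)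

-- Main counting lemma: an increasing list of length m realises at most m - 1
-- levels.  Each step peels off the first pair, which realises at most one level.
realised-bound : ∀ {k} xs → AllPairs _<_ xs → (B : Subset k) →
                 (∀ i → i ∈ B → Realised xs (toℕ i)) → ∣ B ∣ ≤ length xs ∸ 1
realised-bound [] _ B realised =
  ≤-reflexive (∣empty∣≡0 B (λ (i , i∈B) → nothing-realised-[] (realised i i∈B)))
realised-bound (_ ∷ []) _ B realised =
  ≤-reflexive (∣empty∣≡0 B (λ (i , i∈B) → nothing-realised-[x] (realised i i∈B)))
realised-bound (x ∷ y ∷ rest) sorted@(_ ∷ sorted-tail) B realised
  with peel (λ i → splitsAt? x y (toℕ i)) (λ s t → toℕ-injective (splitsAt-unique s t)) B
            (λ i i∈B → realised-∷ sorted (realised i i∈B))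
... | B′ , ∣B∣≤1+∣B′∣ , realised′ =
  ≤-trans ∣B∣≤1+∣B′∣ (s≤s (realised-bound (y ∷ rest) sorted-tail B′ realised′))

members : ∀ {n} → Subset n → List ℕ
members [] = []
members (inside ∷ p) = 0 ∷ map suc (members p)
members (outside ∷ p) = map suc (members p)

members-increasing : ∀ {n} (p : Subset n) → AllPairs _<_ (members p)
members-increasing [] = []
members-increasing (inside ∷ p) =
  All.map⁺ (All.universal (λ _ → z<s) (members p)) ∷
  AllPairs.map⁺ (AllPairs.map s<s (members-increasing p))
members-increasing (outside ∷ p) = AllPairs.map⁺ (AllPairs.map s<s (members-increasing p))

∈-members : ∀ {n} {p : Subset n} {x} → x ∈ p → toℕ x ∈ₗ members p
∈-members here = here refl
∈-members {p = inside ∷ _} (there x∈p) = there (∈-map⁺ suc (∈-members x∈p))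
∈-members {p = outside ∷ _} (there x∈p) = ∈-map⁺ suc (∈-members x∈p)

length-members : ∀ {n} (p : Subset n) → length (members p) ≡ ∣ p ∣
length-members [] = refl
length-members (inside ∷ p) = cong suc (trans (length-map suc (members p)) (length-members p))
length-members (outside ∷ p) = trans (length-map suc (members p)) (length-members p)

binProf⇒realised : ∀ k {Q i} → InBinProf k Q i → Realised (members Q) (toℕ i)
binProf⇒realised k (x , y , x∈Q , y∈Q , x≢y , M) with <-cmp (toℕ x) (toℕ y)
... | tri< x<y _ _ = toℕ x , toℕ y , ∈-members x∈Q , ∈-members y∈Q , x<y , isM⇒splitsAt k M
... | tri≈ _ x≡y _ = contradiction (toℕ-injective x≡y) x≢y
... | tri> _ _ y<x =
  toℕ y , toℕ x , ∈-members y∈Q , ∈-members x∈Q , y<x , splitsAt-sym (isM⇒splitsAt k M)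

lemma4p6 : (k : ℕ) → 1 ≤ k → (Q : Subset (2 ^ k)) → 1 ≤ ∣ Q ∣ →
           (B : Subset k) → ((i : Fin k) → (i ∈ B) ⇔ InBinProf k Q i) →
           ∣ B ∣ ≤ ∣ Q ∣ ∸ 1
lemma4p6 k _ Q _ B B⇔binProf = begin
  ∣ B ∣                    ≤⟨ realised-bound (members Q) (members-increasing Q) B realised ⟩
  length (members Q) ∸ 1   ≡⟨ cong (_∸ 1) (length-members Q) ⟩
  ∣ Q ∣ ∸ 1                ∎
  where
  open ≤-Reasoning
  realised : ∀ i → i ∈ B → Realised (members Q) (toℕ i)
  realised i i∈B = binProf⇒realised k (Equivalence.to (B⇔binProf i) i∈B)
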